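{- For all positive integers $w,n,k$ and all functions $h_1:[w]\to[k]$, $h_2:[n]\to[k]$, the $k$-bin hash defined by $h_1,h_2$ is composition-friendly: whenever $(W_1,T_1)$ and $(W_2,T_2)$ are unit-distance worker/task inputs, the corresponding worker/task outputs $(W_1',T_1')$ and $(W_2',T_2')$ are also unit distance.
   Context: A worker/task input is a pair $(W,T)$ with $W\subseteq[w]$, $T\subseteq[n]$, $|W|=|T|$. The $k$-bin hash defined by $h_1,h_2$ places each $\omega\in W$ in bin $h_1(\omega)$ and each $\tau\in T$ in bin $h_2(\tau)$, and in each bin containing at least one worker and one task matches the smallest such worker to the smallest such task; the worker/task output $(W',T')$ consists of the unmatched workers of $W$ and unmatched tasks of $T$. Pairs $(W_1,T_1),(W_2,T_2)$ are unit distance if $|W_1\setminus W_2|+|W_2\setminus W_1|+|T_1\setminus T_2|+|T_2\setminus T_1|\le 2$. -}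

module Defs where

open import Data.Nat using (ℕ; _+_; _≤_)
open import Data.Bool using (Bool; true; false; _∧_; _∨_; not; if_then_else_)
open import Data.Fin using (Fin; _<?_; _≟_)
open import Data.Fin.Subset using (Subset; _─_; ∣_∣; inside; outside)
open import Data.Vec using (lookup; tabulate; foldr′; map; allFin)
open import Data.Product using (_×_; _,_; proj₁; proj₂)
open import Relation.Nullary.Decidable using (⌊_⌋)
open import Relation.Binary.PropositionalEquality using (_≡_)

-- a worker/task pair over workers [w] and tasks [n] (Fin w, Fin n, 0-indexed);
-- subsets are characteristic vectors (Data.Fin.Subset)
WT : ℕ → ℕ → Set
WT w n = Subset w × Subset n

IsInput : ∀ {w n} → WT w n → Set
IsInput (W , T) = ∣ W ∣ ≡ ∣ T ∣

mem : ∀ {m} → Subset m → Fin m → Bool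
mem S i with lookup S i
... | inside  = true
... | outside = false

fromBool : ∀ {m} → (Fin m → Bool) → Subset m
fromBool f = tabulate (λ i → if f i then inside else outside)

anyFin : ∀ {m} → (Fin m → Bool) → Bool
anyFin {m} p = foldr′ _∨_ false (map p (allFin m))

module _ {w n k : ℕ} (h₁ : Fin w → Fin k) (h₂ : Fin n → Fin k) where

  binHasWorker : Subset w → Fin k → Bool
  binHasWorker W b = anyFin (λ ω → mem W ω ∧ ⌊ h₁ ω ≟ b ⌋)

  binHasTask : Subset n → Fin k → Bool
  binHasTask T b = anyFin (λ τ → mem T τ ∧ ⌊ h₂ τ ≟ b ⌋)

  minWorker : Subset w → Fin w → Bool
  minWorker W ω = mem W ω ∧ not (anyFin (λ ω' → mem W ω' ∧ ⌊ h₁ ω' ≟ h₁ ω ⌋ ∧ ⌊ ω' <? ω ⌋))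

  minTask : Subset n → Fin n → Bool
  minTask T τ = mem T τ ∧ not (anyFin (λ τ' → mem T τ' ∧ ⌊ h₂ τ' ≟ h₂ τ ⌋ ∧ ⌊ τ' <? τ ⌋))

  workerMatched : WT w n → Fin w → Bool
  workerMatched (W , T) ω = minWorker W ω ∧ binHasTask T (h₁ ω)

  taskMatched : WT w n → Fin n → Bool
  taskMatched (W , T) τ = minTask T τ ∧ binHasWorker W (h₂ τ)

  hashOutput : WT w n → WT w n
  hashOutput (W , T) =
    fromBool (λ ω → mem W ω ∧ not (workerMatched (W , T) ω)) ,
    fromBool (λ τ → mem T τ ∧ not (taskMatched (W , T) τ))

dist : ∀ {w n} → WT w n → WT w n → ℕ
dist (W₁ , T₁) (W₂ , T₂) = ∣ W₁ ─ W₂ ∣ + ∣ W₂ ─ W₁ ∣ + ∣ T₁ ─ T₂ ∣ + ∣ T₂ ─ T₁ ∣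

UnitDistance : ∀ {w n} → WT w n → WT w n → Set
UnitDistance P Q = dist P Q ≤ 2

CompositionFriendly : ∀ {w n k} → (Fin w → Fin k) → (Fin n → Fin k) → Set
CompositionFriendly {w} {n} h₁ h₂ =
  ∀ (P Q : WT w n) → IsInput P → IsInput Q → UnitDistance P Q →
  UnitDistance (hashOutput h₁ h₂ P) (hashOutput h₁ h₂ Q)

-- We prove more: the hash is 1-Lipschitz for the distance `dist`, i.e.
--   dist (out P) (out Q) ≤ dist P Q   for ALL pairs P, Q.
--
-- `dist` is the sum of the Hamming distances of the worker and task
-- vectors, so it satisfies the triangle inequality and it suffices to
-- change one coordinate at a time.  The heart of the proof is the
-- single-worker lemma: adding one worker x to W changes the output in at
-- most one coordinate.  Only bin b = h₁ x is affected; a worker other than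
-- x can change only if it was the minimum of bin b and x undercuts it, a
-- task can change only if it is the minimum task of bin b and x is the
-- first worker there, and the case analysis shows at most one of these
-- changes happens.  Removing a worker is the same lemma read backwards,
-- and changing a task is the worker case for the swapped hash (h₂, h₁),
-- which is definitionally the mirror image.

module Submission where

open import Defs
open import Data.Nat using (ℕ; NonZero; zero; suc; _+_; _≤_; z≤n; s≤s)
import Data.Nat.Properties as ℕ
open import Algebra.Properties.CommutativeSemigroup ℕ.+-commutativeSemigroup using (interchange)
open import Data.Fin using (Fin; zero; suc; _≟_; _<?_) renaming (_<_ to _<ᶠ_)
import Data.Fin.Properties as Fin
open import Data.Bool using (Bool; true; false; _∧_; _∨_; not; if_then_else_; _xor_)
open import Data.Bool.Properties using (xor-comm; ∧-zeroʳ; ¬-not) renaming (_≟_ to _≟ᵇ_)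
open import Data.Fin.Subset using (Subset; _─_; ∣_∣)
open import Data.Vec using ([]; _∷_; lookup; tabulate; foldr′; _[_]≔_)
open import Data.Vec.Properties
  using (lookup∘tabulate; tabulate-∘; tabulate-cong; tabulate∘lookup; lookup∘update; lookup∘update′; []≔-lookup)
open import Data.Product using (∃; _×_; _,_; proj₁; proj₂)
open import Data.Sum using (_⊎_; inj₁; inj₂)
open import Data.Empty using (⊥; ⊥-elim)
open import Function using (_∘_; id)
open import Relation.Nullary using (¬_; Dec; yes; no)
open import Relation.Nullary.Decidable using (⌊_⌋; _×-dec_)
open import Relation.Binary using (tri<; tri≈; tri>)
open import Relation.Binary.PropositionalEquality

true≢false : true ≢ false
true≢false ()

∧-elim : ∀ {a b} → a ∧ b ≡ true → a ≡ true × b ≡ true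
∧-elim {true} e = refl , e

∧-intro : ∀ {a b} → a ≡ true → b ≡ true → a ∧ b ≡ true
∧-intro refl refl = refl

∧-not-elim : ∀ {a b} → a ∧ not b ≡ true → a ≡ true × b ≡ false
∧-not-elim {true} {false} _ = refl , refl

∧-not-intro : ∀ {a b} → a ≡ true → b ≡ false → a ∧ not b ≡ true
∧-not-intro refl refl = refl

⌊⌋-sound : ∀ {P : Set} (d : Dec P) → ⌊ d ⌋ ≡ true → P
⌊⌋-sound (yes p) _ = p

⌊⌋-complete : ∀ {P : Set} (d : Dec P) → P → ⌊ d ⌋ ≡ true
⌊⌋-complete (yes _) _ = refl
⌊⌋-complete (no ¬p) p = ⊥-elim (¬p p)

xor-≢ : ∀ {a b} → a xor b ≡ true → a ≢ b
xor-≢ {false} {false} () _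
xor-≢ {true}  {true}  () _

≡⇒xor-false : ∀ {a b} → a ≡ b → a xor b ≡ false
≡⇒xor-false {false} refl = refl
≡⇒xor-false {true}  refl = refl

xor-false⇒≡ : ∀ {a b} → a xor b ≡ false → a ≡ b
xor-false⇒≡ {false} {false} _ = refl
xor-false⇒≡ {true}  {true}  _ = refl

≢-antitone : ∀ {a b} → (b ≡ true → a ≡ true) → a ≢ b → a ≡ true × b ≡ false
≢-antitone {true}  {false} _ _  = refl , refl
≢-antitone {true}  {true}  _ ne = ⊥-elim (ne refl)
≢-antitone {false} {false} _ ne = ⊥-elim (ne refl)
≢-antitone {false} {true}  f _  = ⊥-elim (true≢false (sym (f refl)))

-- An element is kept in the output iff it is present and not matched
-- (`a ∧ not (m ∧ t)`: present a, minimum of its bin m, partner available t).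
absent-dropped : ∀ {a b} → a ≡ false → a ∧ b ≡ false
absent-dropped refl = refl

matched-dropped : ∀ {a m t} → a ≡ true → m ≡ true → t ≡ true → a ∧ not (m ∧ t) ≡ false
matched-dropped refl refl refl = refl

kept-changes-by-min : ∀ a m m' t → a ∧ not (m ∧ t) ≢ a ∧ not (m' ∧ t) →
                      a ≡ true × t ≡ true × m ≢ m'
kept-changes-by-min false m m' t     ne = ⊥-elim (ne refl)
kept-changes-by-min true  m m' true  ne = refl , refl , λ e → ne (cong (λ z → not (z ∧ true)) e)
kept-changes-by-min true  m m' false ne =
  ⊥-elim (ne (cong not (trans (∧-zeroʳ m) (sym (∧-zeroʳ m')))))

kept-changes-by-partner : ∀ a m t t' → a ∧ not (m ∧ t) ≢ a ∧ not (m ∧ t') →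
                          a ≡ true × m ≡ true × t ≢ t'
kept-changes-by-partner false m     t t' ne = ⊥-elim (ne refl)
kept-changes-by-partner true  false t t' ne = ⊥-elim (ne refl)
kept-changes-by-partner true  true  t t' ne = refl , refl , λ e → ne (cong not e)

private
  or-tabulate-intro : ∀ {m} (p : Fin m → Bool) i → p i ≡ true → foldr′ _∨_ false (tabulate p) ≡ true
  or-tabulate-intro p zero e rewrite e = refl
  or-tabulate-intro p (suc i) e with p zero
  ... | true  = refl
  ... | false = or-tabulate-intro (p ∘ suc) i e

  or-tabulate-elim : ∀ {m} (p : Fin m → Bool) → foldr′ _∨_ false (tabulate p) ≡ true → ∃ λ i → p i ≡ true
  or-tabulate-elim {suc m} p e with p zero in e₀
  ... | true  = zero , e₀
  ... | false = let (i , pi) = or-tabulate-elim (p ∘ suc) e in suc i , pi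

anyFin-tabulate : ∀ {m} (p : Fin m → Bool) → anyFin p ≡ foldr′ _∨_ false (tabulate p)
anyFin-tabulate p = cong (foldr′ _∨_ false) (sym (tabulate-∘ p id))

any-intro : ∀ {m} (p : Fin m → Bool) i → p i ≡ true → anyFin p ≡ true
any-intro p i e = trans (anyFin-tabulate p) (or-tabulate-intro p i e)

any-elim : ∀ {m} (p : Fin m → Bool) → anyFin p ≡ true → ∃ λ i → p i ≡ true
any-elim p e = or-tabulate-elim p (trans (sym (anyFin-tabulate p)) e)

witness-or-none : ∀ {m} (p : Fin m → Bool) → (∃ λ i → p i ≡ true) ⊎ (∀ i → p i ≡ false)
witness-or-none p with anyFin p in e
... | true  = inj₁ (any-elim p e)
... | false = inj₂ λ i → ¬-not λ pi → true≢false (trans (sym (any-intro p i pi)) e)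

-- Counting and the Hamming distance

indicator : Bool → ℕ
indicator true  = 1
indicator false = 0

count : ∀ {m} → (Fin m → Bool) → ℕ
count {zero}  f = 0
count {suc m} f = indicator (f zero) + count (f ∘ suc)

count-cong : ∀ {m} {f g : Fin m → Bool} → (∀ i → f i ≡ g i) → count f ≡ count g
count-cong {zero}  e = refl
count-cong {suc m} e = cong₂ _+_ (cong indicator (e zero)) (count-cong (e ∘ suc))

count-none : ∀ {m} {f : Fin m → Bool} → (∀ i → f i ≡ false) → count f ≡ 0
count-none {zero}          e = refl
count-none {suc m} {f} e rewrite e zero = count-none (e ∘ suc)

count≡0⇒none : ∀ {m} (f : Fin m → Bool) → count f ≡ 0 → ∀ i → f i ≡ false
count≡0⇒none f e zero    with f zero
... | false = refl
count≡0⇒none f e (suc i) with f zero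
... | false = count≡0⇒none (f ∘ suc) e i

count-unique : ∀ {m} (f : Fin m → Bool) → (∀ i j → f i ≡ true → f j ≡ true → i ≡ j) → count f ≤ 1
count-unique {zero}  f u = z≤n
count-unique {suc m} f u with f zero in e
... | true  = ℕ.≤-reflexive (cong suc (count-none λ i → ¬-not λ fi → Fin.0≢1+n (u zero (suc i) e fi)))
... | false = count-unique (f ∘ suc) λ i j p q → Fin.suc-injective (u (suc i) (suc j) p q)

count-exclusive : ∀ {m m'} (f : Fin m → Bool) (g : Fin m' → Bool) →
                  (∀ i j → f i ≡ true → f j ≡ true → i ≡ j) →
                  (∀ i j → g i ≡ true → g j ≡ true → i ≡ j) →
                  (∀ i j → f i ≡ true → g j ≡ true → ⊥) →
                  count f + count g ≤ 1
count-exclusive f g uf ug excl with witness-or-none g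
... | inj₂ none = begin
  count f + count g ≡⟨ cong (count f +_) (count-none none) ⟩
  count f + 0       ≡⟨ ℕ.+-identityʳ (count f) ⟩
  count f           ≤⟨ count-unique f uf ⟩
  1                 ∎
  where open ℕ.≤-Reasoning
... | inj₁ (j , gj) = begin
  count f + count g ≡⟨ cong (_+ count g) (count-none λ i → ¬-not λ fi → excl i j fi gj) ⟩
  count g           ≤⟨ count-unique g ug ⟩
  1                 ∎
  where open ℕ.≤-Reasoning

count-remove : ∀ {m} (f g : Fin m → Bool) x → f x ≡ true → g x ≡ false →
               (∀ i → i ≢ x → g i ≡ f i) → count f ≡ suc (count g)
count-remove f g zero fx gx same rewrite fx | gx =
  cong suc (count-cong λ i → sym (same (suc i) λ ()))
count-remove f g (suc x) fx gx same rewrite same zero (λ ()) =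
  trans (cong (indicator (f zero) +_)
              (count-remove (f ∘ suc) (g ∘ suc) x fx gx λ i i≢x → same (suc i) (i≢x ∘ Fin.suc-injective)))
        (ℕ.+-suc (indicator (f zero)) (count (g ∘ suc)))

count-subadditive : ∀ {m} (f g h : Fin m → Bool) → (∀ i → indicator (f i) ≤ indicator (g i) + indicator (h i)) →
                    count f ≤ count g + count h
count-subadditive {zero}  f g h p = z≤n
count-subadditive {suc m} f g h p = begin
  indicator (f zero) + count (f ∘ suc)
    ≤⟨ ℕ.+-mono-≤ (p zero) (count-subadditive (f ∘ suc) (g ∘ suc) (h ∘ suc) (p ∘ suc)) ⟩
  (indicator (g zero) + indicator (h zero)) + (count (g ∘ suc) + count (h ∘ suc))
    ≡⟨ interchange (indicator (g zero)) (indicator (h zero)) (count (g ∘ suc)) (count (h ∘ suc)) ⟩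
  count g + count h ∎
  where open ℕ.≤-Reasoning

hamming : ∀ {m} → Subset m → Subset m → ℕ
hamming A B = count λ i → lookup A i xor lookup B i

∣─∣+∣─∣≡hamming : ∀ {m} (A B : Subset m) → ∣ A ─ B ∣ + ∣ B ─ A ∣ ≡ hamming A B
∣─∣+∣─∣≡hamming []          []          = refl
∣─∣+∣─∣≡hamming (true ∷ A)  (true ∷ B)  = ∣─∣+∣─∣≡hamming A B
∣─∣+∣─∣≡hamming (true ∷ A)  (false ∷ B) = cong suc (∣─∣+∣─∣≡hamming A B)
∣─∣+∣─∣≡hamming (false ∷ A) (true ∷ B)  = trans (ℕ.+-suc _ _) (cong suc (∣─∣+∣─∣≡hamming A B))
∣─∣+∣─∣≡hamming (false ∷ A) (false ∷ B) = ∣─∣+∣─∣≡hamming A B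

hamming-sym : ∀ {m} (A B : Subset m) → hamming A B ≡ hamming B A
hamming-sym A B = count-cong λ i → xor-comm (lookup A i) (lookup B i)

hamming-self : ∀ {m} (A : Subset m) → hamming A A ≡ 0
hamming-self A = count-none λ i → ≡⇒xor-false {lookup A i} refl

hamming≡0⇒≡ : ∀ {m} (A B : Subset m) → hamming A B ≡ 0 → A ≡ B
hamming≡0⇒≡ A B e = begin
  A                  ≡⟨ sym (tabulate∘lookup A) ⟩
  tabulate (lookup A) ≡⟨ tabulate-cong (λ i → xor-false⇒≡ (count≡0⇒none _ e i)) ⟩
  tabulate (lookup B) ≡⟨ tabulate∘lookup B ⟩
  B                  ∎
  where open ≡-Reasoning

hamming-triangle : ∀ {m} (A B C : Subset m) → hamming A C ≤ hamming A B + hamming B C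
hamming-triangle A B C = count-subadditive _ _ _ λ i → xor-triangle (lookup A i) (lookup B i) (lookup C i)
  where
  xor-triangle : ∀ a b c → indicator (a xor c) ≤ indicator (a xor b) + indicator (b xor c)
  xor-triangle false false false = z≤n
  xor-triangle false false true  = s≤s z≤n
  xor-triangle false true  false = z≤n
  xor-triangle false true  true  = s≤s z≤n
  xor-triangle true  false false = s≤s z≤n
  xor-triangle true  false true  = z≤n
  xor-triangle true  true  false = s≤s z≤n
  xor-triangle true  true  true  = z≤n

hamming-fix : ∀ {m} (A B : Subset m) x → lookup A x xor lookup B x ≡ true →
              hamming A B ≡ suc (hamming (A [ x ]≔ lookup B x) B)
hamming-fix A B x differ =
  count-remove _ _ x differ
    (≡⇒xor-false (lookup∘update x A (lookup B x)))
    (λ i i≢x → cong (_xor lookup B i) (lookup∘update′ i≢x A (lookup B x)))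

dist-hamming : ∀ {w n} (P Q : WT w n) → dist P Q ≡ hamming (proj₁ P) (proj₁ Q) + hamming (proj₂ P) (proj₂ Q)
dist-hamming (A , B) (C , D) =
  trans (ℕ.+-assoc (∣ A ─ C ∣ + ∣ C ─ A ∣) ∣ B ─ D ∣ ∣ D ─ B ∣)
        (cong₂ _+_ (∣─∣+∣─∣≡hamming A C) (∣─∣+∣─∣≡hamming B D))

dist-self : ∀ {w n} (P : WT w n) → dist P P ≡ 0
dist-self (A , B) = trans (dist-hamming (A , B) (A , B)) (cong₂ _+_ (hamming-self A) (hamming-self B))

dist-sym : ∀ {w n} (P Q : WT w n) → dist P Q ≡ dist Q P
dist-sym P Q = begin
  dist P Q                                                    ≡⟨ dist-hamming P Q ⟩
  hamming (proj₁ P) (proj₁ Q) + hamming (proj₂ P) (proj₂ Q)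
    ≡⟨ cong₂ _+_ (hamming-sym (proj₁ P) (proj₁ Q)) (hamming-sym (proj₂ P) (proj₂ Q)) ⟩
  hamming (proj₁ Q) (proj₁ P) + hamming (proj₂ Q) (proj₂ P) ≡⟨ sym (dist-hamming Q P) ⟩
  dist Q P                                                    ∎
  where open ≡-Reasoning

dist-swap : ∀ {w n} (A C : Subset w) (B D : Subset n) → dist (A , B) (C , D) ≡ dist (B , A) (D , C)
dist-swap A C B D = begin
  dist (A , B) (C , D)      ≡⟨ dist-hamming (A , B) (C , D) ⟩
  hamming A C + hamming B D ≡⟨ ℕ.+-comm (hamming A C) (hamming B D) ⟩
  hamming B D + hamming A C ≡⟨ sym (dist-hamming (B , A) (D , C)) ⟩
  dist (B , A) (D , C)      ∎
  where open ≡-Reasoning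

dist-triangle : ∀ {w n} (P Q R : WT w n) → dist P R ≤ dist P Q + dist Q R
dist-triangle (A , B) (C , D) (E , F) = begin
  dist (A , B) (E , F)                            ≡⟨ dist-hamming (A , B) (E , F) ⟩
  hamming A E + hamming B F                       ≤⟨ ℕ.+-mono-≤ (hamming-triangle A C E) (hamming-triangle B D F) ⟩
  (hamming A C + hamming C E) + (hamming B D + hamming D F)
    ≡⟨ interchange (hamming A C) (hamming C E) (hamming B D) (hamming D F) ⟩
  (hamming A C + hamming B D) + (hamming C E + hamming D F)
    ≡⟨ sym (cong₂ _+_ (dist-hamming (A , B) (C , D)) (dist-hamming (C , D) (E , F))) ⟩
  dist (A , B) (C , D) + dist (C , D) (E , F)     ∎
  where open ℕ.≤-Reasoning

mem-lookup : ∀ {m} (S : Subset m) i → mem S i ≡ lookup S i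
mem-lookup S i with lookup S i
... | true  = refl
... | false = refl

dist-fromBool : ∀ {w n} (f f' : Fin w → Bool) (g g' : Fin n → Bool) →
                dist (fromBool f , fromBool g) (fromBool f' , fromBool g') ≡
                count (λ i → f i xor f' i) + count (λ i → g i xor g' i)
dist-fromBool f f' g g' =
  trans (dist-hamming (fromBool f , fromBool g) (fromBool f' , fromBool g'))
        (cong₂ _+_ (count-cong λ i → cong₂ _xor_ (lookup-fromBool f i) (lookup-fromBool f' i))
                   (count-cong λ i → cong₂ _xor_ (lookup-fromBool g i) (lookup-fromBool g' i)))
  where
  lookup-fromBool : ∀ {m} (p : Fin m → Bool) i → lookup (fromBool p) i ≡ p i
  lookup-fromBool p i with p i | lookup∘tabulate (λ j → if p j then true else false) i
  ... | true  | e = e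
  ... | false | e = e

-- Minima and occupied bins

IsMin : ∀ {m k} → (Fin m → Fin k) → Subset m → Fin m → Set
IsMin h S i = mem S i ≡ true × (∀ j → mem S j ≡ true → h j ≡ h i → ¬ j <ᶠ i)

Occupied : ∀ {m k} → (Fin m → Fin k) → Subset m → Fin k → Set
Occupied h S c = ∃ λ i → mem S i ≡ true × h i ≡ c

min-unique : ∀ {m k} (h : Fin m → Fin k) (S : Subset m) {i j} →
             IsMin h S i → IsMin h S j → h i ≡ h j → i ≡ j
min-unique h S {i} {j} (i∈S , i-min) (j∈S , j-min) same with Fin.<-cmp i j
... | tri< i<j _ _ = ⊥-elim (j-min i i∈S same i<j)
... | tri≈ _ i≡j _ = i≡j
... | tri> _ _ j<i = ⊥-elim (i-min j j∈S (sym same) j<i)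

module _ {w n k} (h₁ : Fin w → Fin k) (h₂ : Fin n → Fin k) where

  minWorker-sound : ∀ S i → minWorker h₁ h₂ S i ≡ true → IsMin h₁ S i
  minWorker-sound S i e with ∧-not-elim e
  ... | i∈S , no-smaller = i∈S , λ j j∈S same j<i →
    true≢false (trans (sym (any-intro _ j (∧-intro j∈S (∧-intro (⌊⌋-complete (h₁ j ≟ h₁ i) same)
                                                                (⌊⌋-complete (j <? i) j<i))))) no-smaller)

  minWorker-complete : ∀ S i → IsMin h₁ S i → minWorker h₁ h₂ S i ≡ true
  minWorker-complete S i (i∈S , i-min) = ∧-not-intro i∈S (¬-not λ e → smaller-absurd (any-elim _ e))
    where
    smaller-absurd : (∃ λ j → mem S j ∧ ⌊ h₁ j ≟ h₁ i ⌋ ∧ ⌊ j <? i ⌋ ≡ true) → ⊥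
    smaller-absurd (j , e) with ∧-elim e
    ... | j∈S , rest with ∧-elim rest
    ... | same , j<i = i-min j j∈S (⌊⌋-sound (h₁ j ≟ h₁ i) same) (⌊⌋-sound (j <? i) j<i)

  binHasWorker-sound : ∀ S c → binHasWorker h₁ h₂ S c ≡ true → Occupied h₁ S c
  binHasWorker-sound S c e with any-elim _ e
  ... | i , found with ∧-elim found
  ... | i∈S , in-c = i , i∈S , ⌊⌋-sound (h₁ i ≟ c) in-c

  binHasWorker-complete : ∀ S c → Occupied h₁ S c → binHasWorker h₁ h₂ S c ≡ true
  binHasWorker-complete S c (i , i∈S , in-c) = any-intro _ i (∧-intro i∈S (⌊⌋-complete (h₁ i ≟ c) in-c))

-- The single-worker lemma: W' is W with the extra worker x.

module AddWorker {w n k} (h₁ : Fin w → Fin k) (h₂ : Fin n → Fin k) (T : Subset n)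
                 (W W' : Subset w) (x : Fin w)
                 (x∉W : mem W x ≡ false) (x∈W' : mem W' x ≡ true)
                 (elsewhere : ∀ i → i ≢ x → mem W i ≡ mem W' i) where

  keptW : Subset w → Fin w → Bool
  keptW V ω = mem V ω ∧ not (minWorker h₁ h₂ V ω ∧ binHasTask h₁ h₂ T (h₁ ω))

  keptT : Subset w → Fin n → Bool
  keptT V τ = mem T τ ∧ not (minTask h₁ h₂ T τ ∧ binHasWorker h₁ h₂ V (h₂ τ))

  changedW : Fin w → Bool
  changedW ω = keptW W ω xor keptW W' ω

  changedT : Fin n → Bool
  changedT τ = keptT W τ xor keptT W' τ

  W⊆W' : ∀ {i} → mem W i ≡ true → mem W' i ≡ true
  W⊆W' {i} i∈W with i ≟ x
  ... | yes refl = ⊥-elim (true≢false (trans (sym i∈W) x∉W))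
  ... | no i≢x = trans (sym (elsewhere i i≢x)) i∈W

  isMin-shrink : ∀ {ω} → ω ≢ x → IsMin h₁ W' ω → IsMin h₁ W ω
  isMin-shrink {ω} ω≢x (ω∈W' , ω-min) =
    trans (elsewhere ω ω≢x) ω∈W' , λ j j∈W → ω-min j (W⊆W' j∈W)

  isMin-grow : ∀ {ω} → IsMin h₁ W ω → (h₁ x ≡ h₁ ω → x <ᶠ ω → ⊥) → IsMin h₁ W' ω
  isMin-grow {ω} (ω∈W , ω-min) not-undercut = W⊆W' ω∈W , smaller-absurd
    where
    smaller-absurd : ∀ j → mem W' j ≡ true → h₁ j ≡ h₁ ω → ¬ j <ᶠ ω
    smaller-absurd j j∈W' same j<ω with j ≟ x
    ... | yes refl = not-undercut same j<ω
    ... | no j≢x   = ω-min j (trans (elsewhere j j≢x) j∈W') same j<ω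

  new-isMin : (∀ j → mem W j ≡ true → h₁ j ≡ h₁ x → ¬ j <ᶠ x) → IsMin h₁ W' x
  new-isMin none-before = x∈W' , smaller-absurd
    where
    smaller-absurd : ∀ j → mem W' j ≡ true → h₁ j ≡ h₁ x → ¬ j <ᶠ x
    smaller-absurd j j∈W' same j<x with j ≟ x
    ... | yes refl = Fin.<-irrefl refl j<x
    ... | no j≢x   = none-before j (trans (elsewhere j j≢x) j∈W') same j<x

  old-worker-changed : ∀ ω → ω ≢ x → changedW ω ≡ true →
                       h₁ x ≡ h₁ ω × x <ᶠ ω × IsMin h₁ W ω × binHasTask h₁ h₂ T (h₁ ω) ≡ true
  old-worker-changed ω ω≢x changed
    with kept-changes-by-min (mem W' ω) (minWorker h₁ h₂ W ω) (minWorker h₁ h₂ W' ω) (binHasTask h₁ h₂ T (h₁ ω))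
           (subst (λ a → a ∧ _ ≢ _) (elsewhere ω ω≢x) (xor-≢ changed))
  ... | _ , task-there , min-changed
    with ≢-antitone (λ m' → minWorker-complete h₁ h₂ W ω
                               (isMin-shrink ω≢x (minWorker-sound h₁ h₂ W' ω m'))) min-changed
  ... | was-min , not-min with (h₁ x ≟ h₁ ω) ×-dec (x <? ω)
  ... | yes (same , x<ω) = same , x<ω , minWorker-sound h₁ h₂ W ω was-min , task-there
  ... | no not-undercut =
    ⊥-elim (true≢false (trans (sym (minWorker-complete h₁ h₂ W' ω
      (isMin-grow (minWorker-sound h₁ h₂ W ω was-min) λ same x<ω → not-undercut (same , x<ω)))) not-min))

  -- x itself is unchanged (absent from both outputs) when it is matched in W'
  new-worker-unchanged : IsMin h₁ W' x → binHasTask h₁ h₂ T (h₁ x) ≡ true → changedW x ≡ false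
  new-worker-unchanged x-min task-there = ≡⇒xor-false (trans
    (absent-dropped x∉W)
    (sym (matched-dropped x∈W' (minWorker-complete h₁ h₂ W' x x-min) task-there)))

  task-changed : ∀ τ → changedT τ ≡ true → h₂ τ ≡ h₁ x × IsMin h₂ T τ × ¬ Occupied h₁ W (h₁ x)
  task-changed τ changed
    with kept-changes-by-partner (mem T τ) (minTask h₁ h₂ T τ)
           (binHasWorker h₁ h₂ W (h₂ τ)) (binHasWorker h₁ h₂ W' (h₂ τ)) (xor-≢ changed)
  ... | _ , was-min , partner-changed
    with ≢-antitone {binHasWorker h₁ h₂ W' (h₂ τ)} {binHasWorker h₁ h₂ W (h₂ τ)}
           (λ e → let (j , j∈W , in-bin) = binHasWorker-sound h₁ h₂ W (h₂ τ) e
                  in binHasWorker-complete h₁ h₂ W' (h₂ τ) (j , W⊆W' j∈W , in-bin))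
           (partner-changed ∘ sym)
  ... | now-occupied , was-empty with binHasWorker-sound h₁ h₂ W' (h₂ τ) now-occupied
  ... | j , j∈W' , in-bin with j ≟ x
  ... | yes refl = sym in-bin , minWorker-sound h₂ h₁ T τ was-min ,
                   λ occ → true≢false (trans (sym (binHasWorker-complete h₁ h₂ W (h₂ τ)
                                                     (subst (Occupied h₁ W) in-bin occ))) was-empty)
  ... | no j≢x   = ⊥-elim (true≢false (trans (sym (binHasWorker-complete h₁ h₂ W (h₂ τ)
                                         (j , trans (elsewhere j j≢x) j∈W' , in-bin))) was-empty))

  -- if an old worker changes, x was matched and so does not change
  old-excludes-new : ∀ ω → ω ≢ x → changedW ω ≡ true → changedW x ≡ false
  old-excludes-new ω ω≢x changed with old-worker-changed ω ω≢x changed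
  ... | same , x<ω , (_ , ω-min) , task-there =
    new-worker-unchanged
      (new-isMin λ j j∈W in-bin j<x → ω-min j j∈W (trans in-bin same) (Fin.<-trans j<x x<ω))
      (trans (cong (binHasTask h₁ h₂ T) same) task-there)

  workers-unique : ∀ i j → changedW i ≡ true → changedW j ≡ true → i ≡ j
  workers-unique i j ci cj with i ≟ x | j ≟ x
  ... | yes i≡x | yes j≡x = trans i≡x (sym j≡x)
  ... | yes refl | no j≢x = ⊥-elim (true≢false (trans (sym ci) (old-excludes-new j j≢x cj)))
  ... | no i≢x | yes refl = ⊥-elim (true≢false (trans (sym cj) (old-excludes-new i i≢x ci)))
  ... | no i≢x | no j≢x with old-worker-changed i i≢x ci | old-worker-changed j j≢x cj
  ... | same-i , _ , i-min , _ | same-j , _ , j-min , _ = min-unique h₁ W i-min j-min (trans (sym same-i) same-j)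

  tasks-unique : ∀ i j → changedT i ≡ true → changedT j ≡ true → i ≡ j
  tasks-unique i j ci cj with task-changed i ci | task-changed j cj
  ... | bin-i , i-min , _ | bin-j , j-min , _ = min-unique h₂ T i-min j-min (trans bin-i (sym bin-j))

  not-both : ∀ ω τ → changedW ω ≡ true → changedT τ ≡ true → ⊥
  not-both ω τ cω cτ with task-changed τ cτ
  ... | bin-τ , (τ∈T , _) , empty with ω ≟ x
  ... | no ω≢x   = let (same , _ , (ω∈W , _) , _) = old-worker-changed ω ω≢x cω
                   in empty (ω , ω∈W , sym same)
  ... | yes refl = true≢false (trans (sym cω) (new-worker-unchanged
                     (new-isMin λ j j∈W in-bin _ → empty (j , j∈W , in-bin))
                     (binHasWorker-complete h₂ h₁ T (h₁ ω) (τ , τ∈T , bin-τ))))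

  add-worker : dist (hashOutput h₁ h₂ (W , T)) (hashOutput h₁ h₂ (W' , T)) ≤ 1
  add-worker = subst (_≤ 1) (sym (dist-fromBool (keptW W) (keptW W') (keptT W) (keptT W')))
                     (count-exclusive changedW changedT workers-unique tasks-unique not-both)

-- Lipschitz property

update-same : ∀ {m} (S : Subset m) x {v} → lookup S x ≡ v → S [ x ]≔ v ≡ S
update-same S x refl = []≔-lookup S x

update-elsewhere : ∀ {m} (S : Subset m) x v i → i ≢ x → mem (S [ x ]≔ v) i ≡ mem S i
update-elsewhere S x v i i≢x =
  trans (mem-lookup (S [ x ]≔ v) i) (trans (lookup∘update′ i≢x S v) (sym (mem-lookup S i)))

update-worker : ∀ {w n k} (h₁ : Fin w → Fin k) (h₂ : Fin n → Fin k) (W : Subset w) (T : Subset n) x v →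
                dist (hashOutput h₁ h₂ (W , T)) (hashOutput h₁ h₂ (W [ x ]≔ v , T)) ≤ 1
update-worker h₁ h₂ W T x v with lookup W x ≟ᵇ v
... | yes unchanged rewrite update-same W x unchanged =
  subst (_≤ 1) (sym (dist-self (hashOutput h₁ h₂ (W , T)))) z≤n
update-worker h₁ h₂ W T x true  | no changed =
  AddWorker.add-worker h₁ h₂ T W (W [ x ]≔ true) x
    (trans (mem-lookup W x) (¬-not changed)) (trans (mem-lookup (W [ x ]≔ true) x) (lookup∘update x W true))
    (λ i i≢x → sym (update-elsewhere W x true i i≢x))
update-worker h₁ h₂ W T x false | no changed =
  subst (_≤ 1) (dist-sym (hashOutput h₁ h₂ (V , T)) (hashOutput h₁ h₂ (W , T)))
    (AddWorker.add-worker h₁ h₂ T V W x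
       (trans (mem-lookup V x) (lookup∘update x W false)) (trans (mem-lookup W x) (¬-not changed))
       (update-elsewhere W x false))
  where
  V : Subset _
  V = W [ x ]≔ false

worker-lipschitz : ∀ {w n k} (h₁ : Fin w → Fin k) (h₂ : Fin n → Fin k) (T : Subset n) a (W₁ W₂ : Subset w) →
                   hamming W₁ W₂ ≡ a → dist (hashOutput h₁ h₂ (W₁ , T)) (hashOutput h₁ h₂ (W₂ , T)) ≤ a
worker-lipschitz h₁ h₂ T zero W₁ W₂ e rewrite hamming≡0⇒≡ W₁ W₂ e =
  ℕ.≤-reflexive (dist-self (hashOutput h₁ h₂ (W₂ , T)))
worker-lipschitz h₁ h₂ T (suc a) W₁ W₂ e with witness-or-none (λ i → lookup W₁ i xor lookup W₂ i)
... | inj₂ none = ⊥-elim (ℕ.0≢1+n (trans (sym (count-none none)) e))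
... | inj₁ (x , differ) = begin
  dist (out W₁) (out W₂)                       ≤⟨ dist-triangle (out W₁) (out W₁′) (out W₂) ⟩
  dist (out W₁) (out W₁′) + dist (out W₁′) (out W₂)
    ≤⟨ ℕ.+-mono-≤ (update-worker h₁ h₂ W₁ T x (lookup W₂ x)) (worker-lipschitz h₁ h₂ T a W₁′ W₂ closer) ⟩
  suc a                                        ∎
  where
  open ℕ.≤-Reasoning
  out : Subset _ → WT _ _
  out V = hashOutput h₁ h₂ (V , T)
  W₁′ : Subset _
  W₁′ = W₁ [ x ]≔ lookup W₂ x
  closer : hamming W₁′ W₂ ≡ a
  closer = ℕ.suc-injective (trans (sym (hamming-fix W₁ W₂ x differ)) e)

-- changing only tasks: the worker case for the mirrored hash (h₂, h₁)
task-lipschitz : ∀ {w n k} (h₁ : Fin w → Fin k) (h₂ : Fin n → Fin k) (W : Subset w) (T₁ T₂ : Subset n) →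
                 dist (hashOutput h₁ h₂ (W , T₁)) (hashOutput h₁ h₂ (W , T₂)) ≤ hamming T₁ T₂
task-lipschitz h₁ h₂ W T₁ T₂ =
  subst (_≤ hamming T₁ T₂) (sym (dist-swap (proj₁ o₁) (proj₁ o₂) (proj₂ o₁) (proj₂ o₂)))
        (worker-lipschitz h₂ h₁ W _ T₁ T₂ refl)
  where
  o₁ o₂ : WT _ _
  o₁ = hashOutput h₁ h₂ (W , T₁)
  o₂ = hashOutput h₁ h₂ (W , T₂)

hashOutput-lipschitz : ∀ {w n k} (h₁ : Fin w → Fin k) (h₂ : Fin n → Fin k) (P Q : WT w n) →
                       dist (hashOutput h₁ h₂ P) (hashOutput h₁ h₂ Q) ≤ dist P Q
hashOutput-lipschitz h₁ h₂ (W₁ , T₁) (W₂ , T₂) = begin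
  dist (out W₁ T₁) (out W₂ T₂)                          ≤⟨ dist-triangle (out W₁ T₁) (out W₂ T₁) (out W₂ T₂) ⟩
  dist (out W₁ T₁) (out W₂ T₁) + dist (out W₂ T₁) (out W₂ T₂)
    ≤⟨ ℕ.+-mono-≤ (worker-lipschitz h₁ h₂ T₁ _ W₁ W₂ refl) (task-lipschitz h₁ h₂ W₂ T₁ T₂) ⟩
  hamming W₁ W₂ + hamming T₁ T₂                         ≡⟨ sym (dist-hamming (W₁ , T₁) (W₂ , T₂)) ⟩
  dist (W₁ , T₁) (W₂ , T₂)                              ∎
  where
  open ℕ.≤-Reasoning
  out : Subset _ → Subset _ → WT _ _
  out W T = hashOutput h₁ h₂ (W , T)

lemma12 : (w n k : ℕ) → .{{_ : NonZero w}} → .{{_ : NonZero n}} → .{{_ : NonZero k}} →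
          (h₁ : Fin w → Fin k) (h₂ : Fin n → Fin k) → CompositionFriendly h₁ h₂
lemma12 w n k h₁ h₂ P Q _ _ unit = ℕ.≤-trans (hashOutput-lipschitz h₁ h₂ P Q) unit
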